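{- Let $I\subseteq\{1,\ldots,d\}$, let $\lambda$ be a $d$-dimensional extractor, let $\mathbf{C}\subseteq\mathbb{N}^d$, and let $e$ be an infinite word over $\mathbf{C}$. Then $\operatorname{extract}_{\lambda,I}(\mathbf{C})\subseteq\operatorname{extract}_{\lambda,I}(e)$. Moreover, if every element of $\mathbf{C}$ occurs infinitely often in $e$, then $\operatorname{extract}_{\lambda,I}(\mathbf{C})=\operatorname{extract}_{\lambda,I}(e)$.
   Context: A $d$-dimensional extractor is a non-decreasing sequence $\lambda=(\lambda_0\le\cdots\le\lambda_{d+1})$ of positive natural numbers. Given $I\subseteq\{1,\ldots,d\}$ and a set $\mathbf{C}\subseteq\mathbb{N}^d$, a $(\lambda,I)$-small set of $\mathbf{C}$ is a set $J\subseteq I$ with $\mathbf{c}(j)<\lambda_{|J|}$ for all $j\in J$, $\mathbf{c}\in\mathbf{C}$; these sets form a nonempty class closed under union, and $\operatorname{extract}_{\lambda,I}(\mathbf{C})$ is its maximum with respect to inclusion. For finite words of vectors of $\mathbb{N}^d$: $\operatorname{extract}_{\lambda,I}(\varepsilon)=I$ and $\operatorname{extract}_{\lambda,I}(e\mathbf{c})=\operatorname{extract}_{\lambda,J}(\{\mathbf{c}\})$ with $J=\operatorname{extract}_{\lambda,I}(e)$. For an infinite word $e$, the sets $\operatorname{extract}_{\lambda,I}(e_n)$, $e_n$ the prefix of length $n$, form a non-increasing sequence, hence eventually constant; $\operatorname{extract}_{\lambda,I}(e)$ is this eventual value. -}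

module Defs where

open import Data.Nat using (ℕ; zero; suc; _≤_; _<_; s≤s)
open import Data.Nat.Properties using (≤-trans; n≤1+n)
open import Data.Fin using (Fin; fromℕ<)
open import Data.Fin.Subset using (Subset; _⊆_; _∈_; ∣_∣)
open import Data.Fin.Subset.Properties using (∣p∣≤n)
open import Data.Vec using (Vec; lookup)
open import Data.Product using (_×_; Σ)
open import Relation.Binary.PropositionalEquality using (_≡_)

-- Coordinates {1,…,d} are represented by Fin d; vectors of ℕ^d by Vec ℕ d.
-- A d-dimensional extractor (λ_0 ≤ … ≤ λ_{d+1}) is a function on Fin (2+d).
record Extractor (d : ℕ) : Set where
  field
    val      : Fin (suc (suc d)) → ℕ
    positive : ∀ i → 0 < val i
    monotone : ∀ i j → Data.Fin._≤_ i j → val i ≤ val j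

lam-at : ∀ {d} → Extractor d → Subset d → ℕ
lam-at {d} lam J = Extractor.val lam (fromℕ< (s≤s (≤-trans (∣p∣≤n J) (n≤1+n d))))

Small : ∀ {d} → Extractor d → Subset d → (Vec ℕ d → Set) → Subset d → Set
Small lam I C J = J ⊆ I × (∀ j → j ∈ J → ∀ c → C c → lookup c j < lam-at lam J)

IsExtract : ∀ {d} → Extractor d → Subset d → (Vec ℕ d → Set) → Subset d → Set
IsExtract lam I C J = Small lam I C J × (∀ K → Small lam I C K → K ⊆ J)

-- Infinite words over ℕ^d : ℕ → Vec ℕ d.
-- IsExtractPrefix lam I e n J : J = extract_{lam,I}(e_n), e_n the prefix e(0)…e(n-1).
data IsExtractPrefix {d} (lam : Extractor d) (I : Subset d) (e : ℕ → Vec ℕ d)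
       : ℕ → Subset d → Set where
  ε   : IsExtractPrefix lam I e zero I
  snoc : ∀ {n J K} → IsExtractPrefix lam I e n J →
         IsExtract lam J (λ c → c ≡ e n) K → IsExtractPrefix lam I e (suc n) K

IsExtractInf : ∀ {d} → Extractor d → Subset d → (ℕ → Vec ℕ d) → Subset d → Set
IsExtractInf lam I e J = Σ ℕ (λ N → ∀ n → N ≤ n → IsExtractPrefix lam I e n J)

{-# OPTIONS --safe #-}
-- Every small set of C stays small for each singleton {e n}, so by maximality it
-- survives each extraction step along e and lies in extract(e).  Conversely, once
-- the prefix extractions have stabilised at K, each c ∈ C occurs again later in e,
-- and the step extracting K from that occurrence bounds c on K; so K is small for C.
module Submission where

open import Defs
open import Data.Nat using (ℕ; _≤_; _<_; suc)
open import Data.Nat.Properties using (≤-refl; m≤n⇒m≤1+n)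
open import Data.Fin.Subset using (Subset; _⊆_; _∈_)
open import Data.Fin.Subset.Properties using (⊆-antisym)
open import Data.Vec using (Vec; lookup)
open import Data.Product using (_×_; Σ; _,_; proj₁; proj₂)
open import Relation.Binary.PropositionalEquality using (_≡_; refl)

InfinitelyOften : ∀ {d} → (ℕ → Vec ℕ d) → Vec ℕ d → Set
InfinitelyOften e c = ∀ N → Σ ℕ (λ n → N ≤ n × e n ≡ c)

module _ {d} {lam : Extractor d} where

  Small-mono : ∀ {I I′ C D J} → Small lam I C J → J ⊆ I′ →
               (∀ c → D c → C c) → Small lam I′ D J
  Small-mono (_ , bound) J⊆I′ D⊆C = J⊆I′ , λ j j∈J c Dc → bound j j∈J c (D⊆C c Dc)

  IsExtractPrefix⇒⊆ : ∀ {I e n K} → IsExtractPrefix lam I e n K → K ⊆ I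
  IsExtractPrefix⇒⊆ ε                      = λ i∈K → i∈K
  IsExtractPrefix⇒⊆ (snoc p (K-small , _)) = λ i∈K → IsExtractPrefix⇒⊆ p (proj₁ K-small i∈K)

  Small⇒⊆IsExtractPrefix : ∀ {I C J e n K} → Small lam I C J → (∀ m → C (e m)) →
                           IsExtractPrefix lam I e n K → J ⊆ K
  Small⇒⊆IsExtractPrefix J-small e∈C ε = proj₁ J-small
  Small⇒⊆IsExtractPrefix J-small e∈C (snoc {n = n} p (_ , maximal)) =
    maximal _ (Small-mono J-small (Small⇒⊆IsExtractPrefix J-small e∈C p)
                          (λ { _ refl → e∈C n }))

  IsExtractPrefix-bound : ∀ {I e n K} → IsExtractPrefix lam I e (suc n) K →
                          ∀ j → j ∈ K → lookup (e n) j < lam-at lam K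
  IsExtractPrefix-bound (snoc _ (K-small , _)) j j∈K = proj₂ K-small j j∈K _ refl

  IsExtractInf⇒Small : ∀ {I C e K} → IsExtractInf lam I e K →
                       (∀ c → C c → InfinitelyOften e c) → Small lam I C K
  IsExtractInf⇒Small {C = C} {K = K} (N , stable) recurrent =
    IsExtractPrefix⇒⊆ (stable N ≤-refl) , bound
    where
    bound : ∀ j → j ∈ K → ∀ c → C c → lookup c j < lam-at lam K
    bound j j∈K c Cc with recurrent c Cc N
    ... | n , N≤n , refl = IsExtractPrefix-bound (stable (suc n) (m≤n⇒m≤1+n N≤n)) j j∈K

lemma28 : ∀ {d} (I : Subset d) (lam : Extractor d) (C : Vec ℕ d → Set)
    (e : ℕ → Vec ℕ d) → (∀ n → C (e n)) →
    ∀ J K → IsExtract lam I C J → IsExtractInf lam I e K →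
    J ⊆ K ×
    ((∀ c → C c → ∀ N → Σ ℕ (λ n → N ≤ n × e n ≡ c)) → J ≡ K)
lemma28 I lam C e e∈C J K (J-small , J-max) K-extract@(N , stable) =
  J⊆K , λ recurrent → ⊆-antisym J⊆K (J-max K (IsExtractInf⇒Small K-extract recurrent))
  where
  J⊆K : J ⊆ K
  J⊆K = Small⇒⊆IsExtractPrefix J-small e∈C (stable N ≤-refl)
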